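{- If $n\ge2$, then the average number of occurrences of $321$-subwords in $\mathrm{Flatten}(\pi)$, taken over all $\pi\in\mathcal S_n$, equals $\frac{(n-2)(n-3)}{6n}$.
   Context: $\mathcal S_n$ is the set of permutations of $[n]$. For $\pi\in\mathcal S_n$ written in standard cycle form (each cycle begins with its smallest element, cycles ordered left to right by increasing smallest elements), $\mathrm{Flatten}(\pi)$ is the word obtained by erasing the parentheses. An occurrence of a $321$-subword in a word $w$ is an index $i$ with $w_i>w_{i+1}>w_{i+2}$. -}

module Defs where

open import Data.Nat using (ℕ; zero; suc; _+_; _∸_; _≡ᵇ_; _<ᵇ_)
open import Data.Bool using (Bool; true; false; if_then_else_; _∧_)
open import Data.List using (List; []; _∷_; _++_; map; upTo; length)
open import Data.Bool.ListAction using (any)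

range : ℕ → List ℕ
range n = map suc (upTo n)

-- A permutation π of [n] is represented by its one-line notation
-- w = π(1) π(2) ... π(n) (a list that is a rearrangement of [1..n]).
-- app w i = π(i)  (1-indexed; default 0 out of range, never used for permutations)
app : List ℕ → ℕ → ℕ
app []      _             = 0
app (x ∷ _) (suc zero)    = x
app (_ ∷ w) (suc (suc i)) = app w (suc i)
app (_ ∷ _) zero          = 0

-- the cycle of π starting at s: s, π(s), π²(s), ... up to (excluding) the return to s.
-- the fuel bounds the cycle length; n = length w suffices.
cycleFrom : ℕ → List ℕ → ℕ → ℕ → List ℕ
cycleFrom zero    w s c = []
cycleFrom (suc k) w s c =
  c ∷ (if app w c ≡ᵇ s then [] else cycleFrom k w s (app w c))

cycleOf : List ℕ → ℕ → List ℕ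
cycleOf w s = cycleFrom (length w) w s s

elem : ℕ → List ℕ → Bool
elem x = any (λ y → y ≡ᵇ x)

-- scan i = 1,2,...,n; whenever i is not yet in an emitted cycle, it is the
-- smallest element of its cycle, and its cycle (starting at i) is emitted next.
-- This produces the standard cycle form with parentheses erased.
flattenGo : List ℕ → List ℕ → List ℕ → List ℕ
flattenGo w []       seen = []
flattenGo w (i ∷ is) seen =
  if elem i seen then flattenGo w is seen
  else (cycleOf w i ++ flattenGo w is (cycleOf w i ++ seen))

Flatten : List ℕ → List ℕ
Flatten w = flattenGo w (range (length w)) []

occ321 : List ℕ → ℕ
occ321 (a ∷ b ∷ c ∷ r) =
  (if (b <ᵇ a) ∧ (c <ᵇ b) then 1 else 0) + occ321 (b ∷ c ∷ r)
occ321 _ = 0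

-- Every permutation of [n+1] arises exactly once from a permutation u of [n], either by
-- inserting n+1 into the cycle of some x right after x, or by adding n+1 as a fixed point.
-- On flattened standard cycle forms this inserts n+1 right after the letter x of Flatten u,
-- resp. appends it. Inserting a new maximum after each letter of a word v of length n, and
-- appending it, changes the number of 321-occurrences and of descents in a controlled way
-- (Flatten u begins with 1, so it has no descent at the front). Hence, with O n, D n and N n
-- the total 321-count, the total descent count and the number of permutations,
--   O (n+1) + O n = n O n + D n,   D (n+1) + N n = n D n + n N n,   N (n+1) = (n+1) N n,
-- which give 2 D (n+1) = n (n-1) N n and 6 O (n+1) = (n-1)(n-2) N n.

module Submission where

open import Defs
open import Data.Bool using (true; false; if_then_else_; _∧_; T)
open import Data.Bool.Properties using (∧-zeroʳ; T-≡; ⇔→≡)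
open import Data.Empty using (⊥; ⊥-elim)
open import Data.List using (List; []; _∷_; _++_; [_]; map; length; concatMap; upTo; initLast; _∷ʳ′_)
open import Data.List.Properties
  using (map-++; map-∘; map-cong-local; length-map; length-++; length-upTo; upTo-∷ʳ; ++-assoc; ++-identityʳ; concatMap-++)
open import Data.List.Membership.Propositional using (_∈_; _∉_; find; lose)
open import Data.List.Membership.Propositional.Properties
  using (∈-∃++; ∈-++⁺ˡ; ∈-++⁺ʳ; ∈-++⁻; ∈-map⁺; ∈-map⁻; ∈-concatMap⁺; ∈-concatMap⁻;
         ∈-upTo⁺; ∈-upTo⁻)
open import Data.List.Relation.Unary.All as All using (All; []; _∷_)
open import Data.List.Relation.Unary.All.Properties using (¬Any⇒All¬) renaming (++⁺ to All-++⁺; map⁺ to All-map⁺)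
open import Data.List.Relation.Unary.Any as Any using (here; there)
open import Data.List.Relation.Unary.Any.Properties using (any⁺; any⁻)
open import Data.List.Relation.Unary.AllPairs using ([]; _∷_)
open import Data.List.Relation.Unary.Unique.Propositional using (Unique)
open import Data.List.Relation.Unary.Unique.Propositional.Properties using (++⁺; map⁺; upTo⁺; Unique[x∷xs]⇒x∉xs)
open import Data.List.Relation.Binary.Permutation.Propositional
  using (_↭_; prep; swap; ↭-refl; ↭-sym; ↭-trans; ↭⇒↭ₛ; module PermutationReasoning)
open import Data.List.Relation.Binary.Permutation.Propositional.Properties
  using (∈-resp-↭; shift; ∷↭∷ʳ; ↭-empty-inv; drop-mid; ↭-length; ++⁺ˡ; ++⁺ʳ) renaming (map⁺ to ↭-map⁺)
import Data.List.Relation.Binary.Permutation.Setoid.Properties as Setoid↭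
open import Data.Nat using (ℕ; zero; suc; _+_; _*_; _∸_; _≤_; _<_; z≤n; s≤s; _≡ᵇ_; _<ᵇ_; _≟_)
open import Data.Nat.Properties
open import Data.List.Membership.DecPropositional _≟_ using (_∈?_)
open import Data.Nat.ListAction using (sum)
open import Data.Nat.ListAction.Properties using (sum-++; sum-↭)
open import Data.Nat.Tactic.RingSolver using (solve-∀)
open import Data.Product using (Σ-syntax; _×_; _,_; proj₁; proj₂)
open import Data.Sum using (_⊎_; inj₁; inj₂; [_,_]′)
open import Function using (_∘_)
open import Function.Bundles using (_⇔_; Equivalence; mk⇔)
open import Relation.Nullary using (¬_; yes; no)
open import Relation.Binary.PropositionalEquality
  using (_≡_; _≢_; refl; sym; trans; cong; cong₂; subst; subst₂; setoid; module ≡-Reasoning)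

module _ {A : Set} where

  sum-map-+ : (f g : A → ℕ) (xs : List A) →
              sum (map (λ x → f x + g x) xs) ≡ sum (map f xs) + sum (map g xs)
  sum-map-+ f g []       = refl
  sum-map-+ f g (x ∷ xs) rewrite sum-map-+ f g xs = interchange (f x) (g x) _ _
    where
    interchange : ∀ a b c d → a + b + (c + d) ≡ a + c + (b + d)
    interchange = solve-∀

  sum-map-*ˡ : ∀ k (f : A → ℕ) xs → sum (map (λ x → k * f x) xs) ≡ k * sum (map f xs)
  sum-map-*ˡ k f []       = sym (*-zeroʳ k)
  sum-map-*ˡ k f (x ∷ xs) =
    trans (cong (k * f x +_) (sum-map-*ˡ k f xs)) (sym (*-distribˡ-+ k (f x) _))

  sum-map-const : ∀ k (xs : List A) → sum (map (λ _ → k) xs) ≡ length xs * k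
  sum-map-const k []       = refl
  sum-map-const k (x ∷ xs) = cong (k +_) (sum-map-const k xs)

  sum-map-cong-∈ : (f g : A → ℕ) (xs : List A) → (∀ {x} → x ∈ xs → f x ≡ g x) →
                   sum (map f xs) ≡ sum (map g xs)
  sum-map-cong-∈ f g xs f≡g = cong sum (map-cong-local (All.tabulate f≡g))

  sum-map-concatMap : ∀ {B : Set} (f : B → ℕ) (g : A → List B) xs →
                      sum (map f (concatMap g xs)) ≡ sum (map (λ x → sum (map f (g x))) xs)
  sum-map-concatMap f g []       = refl
  sum-map-concatMap f g (x ∷ xs) = begin
    sum (map f (g x ++ concatMap g xs))             ≡⟨ cong sum (map-++ f (g x) _) ⟩
    sum (map f (g x) ++ map f (concatMap g xs))     ≡⟨ sum-++ (map f (g x)) _ ⟩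
    sum (map f (g x)) + sum (map f (concatMap g xs)) ≡⟨ cong (sum (map f (g x)) +_) (sum-map-concatMap f g xs) ⟩
    sum (map (λ y → sum (map f (g y))) (x ∷ xs))   ∎
    where open ≡-Reasoning

  length-concatMap : ∀ {B : Set} (g : A → List B) xs →
                     length (concatMap g xs) ≡ sum (map (length ∘ g) xs)
  length-concatMap g []       = refl
  length-concatMap g (x ∷ xs) = trans (length-++ (g x)) (cong (length (g x) +_) (length-concatMap g xs))

  Unique-resp-↭ : ∀ {xs ys : List A} → xs ↭ ys → Unique xs → Unique ys
  Unique-resp-↭ p = Setoid↭.Unique-resp-↭ (setoid A) (↭⇒↭ₛ p)

  Unique-∷ : ∀ {x : A} {xs} → x ∉ xs → Unique xs → Unique (x ∷ xs)
  Unique-∷ x∉xs xs! = ¬Any⇒All¬ _ x∉xs ∷ xs!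

  Unique-tail : ∀ {x : A} {xs} → Unique (x ∷ xs) → Unique xs
  Unique-tail (_ ∷ xs!) = xs!

  Unique-sameMembers⇒↭ : ∀ {xs ys : List A} → Unique xs → Unique ys →
    (∀ {z} → z ∈ xs → z ∈ ys) → (∀ {z} → z ∈ ys → z ∈ xs) → xs ↭ ys
  Unique-sameMembers⇒↭ {[]}     {[]}     _   _   _    _    = ↭-refl
  Unique-sameMembers⇒↭ {[]}     {y ∷ ys} _   _   _    ys⊆ with () ← ys⊆ (here refl)
  Unique-sameMembers⇒↭ {x ∷ xs} {ys}     xs! ys! xs⊆ ys⊆
    with as , bs , refl ← ∈-∃++ (xs⊆ (here refl)) =
    ↭-trans (prep x (Unique-sameMembers⇒↭ (Unique-tail xs!) as++bs! ⊆ˡ ⊆ʳ))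
            (↭-sym (shift x as bs))
    where
    x∷as++bs! : Unique (x ∷ as ++ bs)
    x∷as++bs! = Unique-resp-↭ (shift x as bs) ys!
    as++bs! = Unique-tail x∷as++bs!
    ⊆ˡ : ∀ {z} → z ∈ xs → z ∈ as ++ bs
    ⊆ˡ z∈xs with ∈-resp-↭ (shift x as bs) (xs⊆ (there z∈xs))
    ... | here refl = ⊥-elim (Unique[x∷xs]⇒x∉xs xs! z∈xs)
    ... | there z∈ = z∈
    ⊆ʳ : ∀ {z} → z ∈ as ++ bs → z ∈ xs
    ⊆ʳ z∈ with ys⊆ (∈-resp-↭ (↭-sym (shift x as bs)) (there z∈))
    ... | here refl = ⊥-elim (Unique[x∷xs]⇒x∉xs x∷as++bs! z∈)
    ... | there z∈xs = z∈xs

  Unique-map⁺-injectiveOn : ∀ {B : Set} (f : A → B) {xs} →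
    (∀ {x y} → x ∈ xs → y ∈ xs → f x ≡ f y → x ≡ y) → Unique xs → Unique (map f xs)
  Unique-map⁺-injectiveOn f {[]}     _   _           = []
  Unique-map⁺-injectiveOn f {x ∷ xs} inj (x∉xs ∷ xs!) =
    All-map⁺ (All.tabulate (λ y∈xs fx≡fy → All.lookup x∉xs y∈xs (inj (here refl) (there y∈xs) fx≡fy)))
    ∷ Unique-map⁺-injectiveOn f (λ x∈ y∈ → inj (there x∈) (there y∈)) xs!

  Unique-concatMap⁺ : ∀ {B : Set} (g : A → List B) (r : B → A) {xs} →
    (∀ {x w} → x ∈ xs → w ∈ g x → r w ≡ x) → (∀ {x} → x ∈ xs → Unique (g x)) →
    Unique xs → Unique (concatMap g xs)
  Unique-concatMap⁺ g r {[]}     _     _  _            = []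
  Unique-concatMap⁺ g r {x ∷ xs} r-inv g! (x∉xs ∷ xs!) =
    ++⁺ (g! (here refl)) (Unique-concatMap⁺ g r (r-inv ∘ there) (g! ∘ there) xs!) disjoint
    where
    disjoint : ∀ {w} → w ∈ g x × w ∈ concatMap g xs → ⊥
    disjoint (w∈gx , w∈gxs) with y , y∈xs , w∈gy ← find (∈-concatMap⁻ g w∈gxs) =
      All.lookup x∉xs y∈xs (trans (sym (r-inv (here refl) w∈gx)) (r-inv (there y∈xs) w∈gy))

¬T⇒≡false : ∀ {b} → ¬ T b → b ≡ false
¬T⇒≡false {false} _ = refl
¬T⇒≡false {true}  ¬t = ⊥-elim (¬t _)

<⇒<ᵇ≡true : ∀ {m n} → m < n → (m <ᵇ n) ≡ true
<⇒<ᵇ≡true m<n = Equivalence.to T-≡ (<⇒<ᵇ m<n)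

<⇒>ᵇ≡false : ∀ {m n} → m < n → (n <ᵇ m) ≡ false
<⇒>ᵇ≡false {m} {n} m<n = ¬T⇒≡false (λ n<ᵇm → <-asym m<n (<ᵇ⇒< n m n<ᵇm))

≡⇒≡ᵇ≡true : ∀ {m n} → m ≡ n → (m ≡ᵇ n) ≡ true
≡⇒≡ᵇ≡true {m} {n} m≡n = Equivalence.to T-≡ (≡⇒≡ᵇ m n m≡n)

≢⇒≡ᵇ≡false : ∀ {m n} → m ≢ n → (m ≡ᵇ n) ≡ false
≢⇒≡ᵇ≡false {m} {n} m≢n = ¬T⇒≡false (m≢n ∘ ≡ᵇ⇒≡ m n)

elem≡true⇔∈ : ∀ {z l} → elem z l ≡ true ⇔ z ∈ l
elem≡true⇔∈ {z} {l} = mk⇔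
  (λ e → Any.map (λ {y} t → sym (≡ᵇ⇒≡ y z t)) (any⁻ _ l (Equivalence.from T-≡ e)))
  (λ z∈ → Equivalence.to T-≡ (any⁺ _ (Any.map (λ {y} z≡y → ≡⇒≡ᵇ y z (sym z≡y)) z∈)))

∉⇒elem≡false : ∀ {z l} → z ∉ l → elem z l ≡ false
∉⇒elem≡false z∉ = ¬T⇒≡false (z∉ ∘ Equivalence.to elem≡true⇔∈ ∘ Equivalence.to T-≡)

elem-cong : ∀ {z a b} → (z ∈ a → z ∈ b) → (z ∈ b → z ∈ a) → elem z a ≡ elem z b
elem-cong a⊆b b⊆a = ⇔→≡ (mk⇔
  (Equivalence.from elem≡true⇔∈ ∘ a⊆b ∘ Equivalence.to elem≡true⇔∈)
  (Equivalence.from elem≡true⇔∈ ∘ b⊆a ∘ Equivalence.to elem≡true⇔∈))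

-- Descents and 321-occurrences under insertion of a new maximum

headDescent : List ℕ → ℕ
headDescent (a ∷ b ∷ _) = if b <ᵇ a then 1 else 0
headDescent _           = 0

descents : List ℕ → ℕ
descents []      = 0
descents (a ∷ u) = headDescent (a ∷ u) + descents u

lead321 : ℕ → List ℕ → ℕ
lead321 a (b ∷ c ∷ _) = if (b <ᵇ a) ∧ (c <ᵇ b) then 1 else 0
lead321 a _           = 0

occ321-∷ : ∀ a u → occ321 (a ∷ u) ≡ lead321 a u + occ321 u
occ321-∷ a []          = refl
occ321-∷ a (b ∷ [])    = refl
occ321-∷ a (b ∷ c ∷ u) = refl

insertions : ℕ → List ℕ → List (List ℕ)
insertions M []      = []
insertions M (a ∷ u) = (a ∷ M ∷ u) ∷ map (a ∷_) (insertions M u)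

length-insertions : ∀ M u → length (insertions M u) ≡ length u
length-insertions M []      = refl
length-insertions M (a ∷ u) = cong suc (trans (length-map (a ∷_) (insertions M u)) (length-insertions M u))

sum-map-insertions-∷ : ∀ (f : List ℕ → ℕ) M a u →
  sum (map f (insertions M (a ∷ u))) ≡ f (a ∷ M ∷ u) + sum (map (f ∘ (a ∷_)) (insertions M u))
sum-map-insertions-∷ f M a u = cong (λ xs → f (a ∷ M ∷ u) + sum xs) (sym (map-∘ (insertions M u)))

module _ {M : ℕ} where

  lead321-insertions : ∀ a b u → All (_< M) (b ∷ u) →
    sum (map (lead321 a) (insertions M (b ∷ u))) ≡ length u * lead321 a (b ∷ u)
  lead321-insertions a b []      (b<M ∷ _) rewrite <⇒>ᵇ≡false b<M | ∧-zeroʳ (b <ᵇ a) = refl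
  lead321-insertions a b (c ∷ u) (b<M ∷ _) rewrite <⇒>ᵇ≡false b<M | ∧-zeroʳ (b <ᵇ a) =
    cong (t +_) (begin
      sum (map (lead321 a) (map (b ∷_) (map (c ∷_) (insertions M u))))
        ≡⟨ cong sum (trans (sym (map-∘ _)) (sym (map-∘ (insertions M u)))) ⟩
      sum (map (λ _ → t) (insertions M u))   ≡⟨ sum-map-const t (insertions M u) ⟩
      length (insertions M u) * t            ≡⟨ cong (_* t) (length-insertions M u) ⟩
      length u * t                           ∎)
    where
    open ≡-Reasoning
    t = lead321 a (b ∷ c ∷ u)

  lead321-max : ∀ u → All (_< M) u → lead321 M u ≡ headDescent u
  lead321-max []          _         = refl
  lead321-max (b ∷ [])    _         = refl
  lead321-max (b ∷ c ∷ u) (b<M ∷ _) rewrite <⇒<ᵇ≡true b<M = refl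

  lead321-below-max : ∀ {a} u → a < M → lead321 a (M ∷ u) ≡ 0
  lead321-below-max []      _   = refl
  lead321-below-max (c ∷ u) a<M rewrite <⇒>ᵇ≡false a<M = refl

  -- Inserting M after v_i destroys the 321-occurrences starting at i - 1 and i, and creates one
  -- at M exactly when v_{i+1} v_{i+2} is a descent: every occurrence is destroyed twice and every
  -- descent but the first one is created once.
  occ321-insertions : ∀ v → All (_< M) v →
    sum (map occ321 (insertions M v)) + 2 * occ321 v + headDescent v ≡ length v * occ321 v + descents v
  occ321-insertions []          _              = refl
  occ321-insertions (a ∷ [])    _              = refl
  occ321-insertions (a ∷ b ∷ u) (a<M ∷ u<M) = begin
      S + 2 * occ321 (a ∷ v) + hd
    ≡⟨ cong₂ (λ x y → x + 2 * y + hd) front (occ321-∷ a v) ⟩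
      (headDescent v + occ321 v + (length u * t + Σ)) + 2 * (t + occ321 v) + hd
    ≡⟨ regroup (headDescent v) (occ321 v) (length u) t Σ hd ⟩
      (Σ + 2 * occ321 v + headDescent v) + (occ321 v + length u * t + 2 * t + hd)
    ≡⟨ cong (_+ (occ321 v + length u * t + 2 * t + hd)) (occ321-insertions v u<M) ⟩
      (length v * occ321 v + descents v) + (occ321 v + length u * t + 2 * t + hd)
    ≡⟨ collect (length u) (occ321 v) (descents v) t hd ⟩
      length (a ∷ v) * (t + occ321 v) + (hd + descents v)
    ≡⟨ cong (λ z → length (a ∷ v) * z + (hd + descents v)) (sym (occ321-∷ a v)) ⟩
      length (a ∷ v) * occ321 (a ∷ v) + descents (a ∷ v)
    ∎
    where
    open ≡-Reasoning
    v  = b ∷ u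
    S  = sum (map occ321 (insertions M (a ∷ v)))
    Σ  = sum (map occ321 (insertions M v))
    t  = lead321 a v
    hd = headDescent (a ∷ v)
    front : S ≡ headDescent v + occ321 v + (length u * t + Σ)
    front = begin
        S
      ≡⟨ sum-map-insertions-∷ occ321 M a v ⟩
        occ321 (a ∷ M ∷ v) + sum (map (occ321 ∘ (a ∷_)) (insertions M v))
      ≡⟨ cong₂ _+_ (trans (occ321-∷ a (M ∷ v)) (cong₂ _+_ (lead321-below-max v a<M) (occ321-∷ M v)))
                   (sum-map-cong-∈ _ _ (insertions M v) (λ {w} _ → occ321-∷ a w)) ⟩
        lead321 M v + occ321 v + sum (map (λ w → lead321 a w + occ321 w) (insertions M v))
      ≡⟨ cong₂ (λ x y → x + occ321 v + y) (lead321-max v u<M) (sum-map-+ (lead321 a) occ321 (insertions M v)) ⟩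
        headDescent v + occ321 v + (sum (map (lead321 a) (insertions M v)) + Σ)
      ≡⟨ cong (λ z → headDescent v + occ321 v + (z + Σ)) (lead321-insertions a b u u<M) ⟩
        headDescent v + occ321 v + (length u * t + Σ)
      ∎
    regroup : ∀ d o l t s e → (d + o + (l * t + s)) + 2 * (t + o) + e ≡ (s + 2 * o + d) + (o + l * t + 2 * t + e)
    regroup = solve-∀
    collect : ∀ l o ds t e → (suc l * o + ds) + (o + l * t + 2 * t + e) ≡ suc (suc l) * (t + o) + (e + ds)
    collect = solve-∀

  -- Inserting M after v_i removes the descent at i, if any, and creates one at M unless i is last.
  descents-insertions : ∀ a u → All (_< M) (a ∷ u) →
    sum (map descents (insertions M (a ∷ u))) + descents (a ∷ u) + 1 ≡ suc (length u) * descents (a ∷ u) + suc (length u)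
  descents-insertions a []      (a<M ∷ _) rewrite <⇒>ᵇ≡false a<M = refl
  descents-insertions a (b ∷ u) (a<M ∷ v<M@(b<M ∷ _)) = begin
      (descents (a ∷ M ∷ v) + sum (map descents (map (a ∷_) (insertions M v)))) + (e + descents v) + 1
    ≡⟨ cong (λ z → (z + sum (map descents (map (a ∷_) (insertions M v)))) + (e + descents v) + 1) front ⟩
      (1 + descents v + sum (map descents (map (a ∷_) (insertions M v)))) + (e + descents v) + 1
    ≡⟨ cong (λ z → (1 + descents v + z) + (e + descents v) + 1) rest ⟩
      (1 + descents v + (length v * e + Σ)) + (e + descents v) + 1
    ≡⟨ regroup (descents v) (length v) e Σ ⟩
      (Σ + descents v + 1) + (length v * e + e + descents v + 1)
    ≡⟨ cong (_+ (length v * e + e + descents v + 1)) (descents-insertions b u v<M) ⟩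
      (length v * descents v + length v) + (length v * e + e + descents v + 1)
    ≡⟨ collect (length v) (descents v) e ⟩
      suc (length v) * (e + descents v) + suc (length v)
    ∎
    where
    open ≡-Reasoning
    v = b ∷ u
    e = headDescent (a ∷ v)
    Σ = sum (map descents (insertions M v))
    front : descents (a ∷ M ∷ v) ≡ 1 + descents v
    front rewrite <⇒>ᵇ≡false a<M | <⇒<ᵇ≡true b<M = refl
    rest : sum (map descents (map (a ∷_) (insertions M v))) ≡ length v * e + Σ
    rest = begin
        sum (map descents (map (a ∷_) (insertions M v)))
      ≡⟨ cong sum (sym (map-∘ (insertions M v))) ⟩
        sum (map (λ w → headDescent (a ∷ w) + descents w) (insertions M v))
      ≡⟨ sum-map-+ (headDescent ∘ (a ∷_)) descents (insertions M v) ⟩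
        sum (map (headDescent ∘ (a ∷_)) (insertions M v)) + Σ
      ≡⟨ cong (_+ Σ) (sum-map-insertions-∷ (headDescent ∘ (a ∷_)) M b u) ⟩
        e + sum (map (λ _ → e) (insertions M u)) + Σ
      ≡⟨ cong (λ z → e + z + Σ) (trans (sum-map-const e (insertions M u)) (cong (_* e) (length-insertions M u))) ⟩
        length v * e + Σ
      ∎
    regroup : ∀ d l e s → (1 + d + (l * e + s)) + (e + d) + 1 ≡ (s + d + 1) + (l * e + e + d + 1)
    regroup = solve-∀
    collect : ∀ l d e → (l * d + l) + (l * e + e + d + 1) ≡ suc l * (e + d) + suc l
    collect = solve-∀

  occ321-∷ʳ-max : ∀ u → All (_< M) u → occ321 (u ++ [ M ]) ≡ occ321 u
  occ321-∷ʳ-max []          _              = refl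
  occ321-∷ʳ-max (a ∷ [])    _              = refl
  occ321-∷ʳ-max (a ∷ b ∷ []) (_ ∷ b<M ∷ _) rewrite <⇒>ᵇ≡false b<M | ∧-zeroʳ (b <ᵇ a) = refl
  occ321-∷ʳ-max (a ∷ b ∷ c ∷ u) (_ ∷ u<M) = cong (lead321 a (b ∷ c ∷ u) +_) (occ321-∷ʳ-max (b ∷ c ∷ u) u<M)

  descents-∷ʳ-max : ∀ u → All (_< M) u → descents (u ++ [ M ]) ≡ descents u
  descents-∷ʳ-max []          _              = refl
  descents-∷ʳ-max (a ∷ [])    (a<M ∷ _) rewrite <⇒>ᵇ≡false a<M = refl
  descents-∷ʳ-max (a ∷ b ∷ u) (_ ∷ u<M) = cong (headDescent (a ∷ b ∷ u) +_) (descents-∷ʳ-max (b ∷ u) u<M)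

-- Enumerating the permutations of [n] by cycle insertion

InRange : ℕ → ℕ → Set
InRange n c = 1 ≤ c × c ≤ n

∈-range⁻ : ∀ {n z} → z ∈ range n → InRange n z
∈-range⁻ z∈ with _ , i∈ , refl ← ∈-map⁻ suc z∈ = s≤s z≤n , ∈-upTo⁻ i∈

∈-range⁺ : ∀ {n z} → InRange n z → z ∈ range n
∈-range⁺ {z = suc z} (_ , z<n) = ∈-map⁺ suc (∈-upTo⁺ z<n)

range-suc : ∀ n → range (suc n) ≡ range n ++ [ suc n ]
range-suc n = trans (cong (map suc) (sym (upTo-∷ʳ n))) (map-++ suc (upTo n) [ n ])

Unique-range : ∀ n → Unique (range n)
Unique-range n = map⁺ suc-injective (upTo⁺ n)

length-range : ∀ n → length (range n) ≡ n
length-range n = trans (length-map suc (upTo n)) (length-upTo n)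

length-↭-range : ∀ {n u} → u ↭ range n → length u ≡ n
length-↭-range {n} p = trans (↭-length p) (length-range n)

suc-∉-↭-range : ∀ {n u} → u ↭ range n → suc n ∉ u
suc-∉-↭-range p n+1∈ = 1+n≰n (proj₂ (∈-range⁻ (∈-resp-↭ p n+1∈)))

-- 1-indexed like app; position 0 and positions past the end change nothing.
setAt : List ℕ → ℕ → ℕ → List ℕ
setAt []      _             _ = []
setAt (a ∷ u) zero          _ = a ∷ u
setAt (a ∷ u) (suc zero)    v = v ∷ u
setAt (a ∷ u) (suc (suc c)) v = a ∷ setAt u (suc c) v

length-setAt : ∀ u c v → length (setAt u c v) ≡ length u
length-setAt []      _             _ = refl
length-setAt (a ∷ u) zero          _ = refl
length-setAt (a ∷ u) (suc zero)    _ = refl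
length-setAt (a ∷ u) (suc (suc c)) v = cong suc (length-setAt u (suc c) v)

app-mid : ∀ as y bs → app (as ++ y ∷ bs) (suc (length as)) ≡ y
app-mid []       y bs = refl
app-mid (a ∷ as) y bs = app-mid as y bs

setAt-mid : ∀ as y bs v → setAt (as ++ y ∷ bs) (suc (length as)) v ≡ as ++ v ∷ bs
setAt-mid []       y bs v = refl
setAt-mid (a ∷ as) y bs v = cong (a ∷_) (setAt-mid as y bs v)

app-++ˡ : ∀ u v {c} → 1 ≤ c → c ≤ length u → app (u ++ v) c ≡ app u c
app-++ˡ (a ∷ u) v {suc zero}    _ _         = refl
app-++ˡ (a ∷ u) v {suc (suc c)} _ (s≤s c<) = app-++ˡ u v (s≤s z≤n) c<

app-∈ : ∀ u {c} → 1 ≤ c → c ≤ length u → app u c ∈ u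
app-∈ (a ∷ u) {suc zero}    _ _         = here refl
app-∈ (a ∷ u) {suc (suc c)} _ (s≤s c<) = there (app-∈ u (s≤s z≤n) c<)

app-setAt : ∀ u {c} v → 1 ≤ c → c ≤ length u → app (setAt u c v) c ≡ v
app-setAt (a ∷ u) {suc zero}    v _ _         = refl
app-setAt (a ∷ u) {suc (suc c)} v _ (s≤s c<) = app-setAt u v (s≤s z≤n) c<

app-setAt-≢ : ∀ u x v c → c ≢ x → app (setAt u x v) c ≡ app u c
app-setAt-≢ []      _             _ _             _   = refl
app-setAt-≢ (a ∷ u) zero          _ _             _   = refl
app-setAt-≢ (a ∷ u) (suc zero)    _ zero          _   = refl
app-setAt-≢ (a ∷ u) (suc zero)    _ (suc zero)    c≢x = ⊥-elim (c≢x refl)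
app-setAt-≢ (a ∷ u) (suc zero)    _ (suc (suc c)) _   = refl
app-setAt-≢ (a ∷ u) (suc (suc x)) _ zero          _   = refl
app-setAt-≢ (a ∷ u) (suc (suc x)) _ (suc zero)    _   = refl
app-setAt-≢ (a ∷ u) (suc (suc x)) v (suc (suc c)) c≢x = app-setAt-≢ u (suc x) v (suc c) (c≢x ∘ cong suc)

splitAt : ∀ u {c} → 1 ≤ c → c ≤ length u →
  Σ[ as ∈ List ℕ ] Σ[ y ∈ ℕ ] Σ[ bs ∈ List ℕ ] (u ≡ as ++ y ∷ bs × suc (length as) ≡ c)
splitAt (a ∷ u) {suc zero}    _ _ = [] , a , u , refl , refl
splitAt (a ∷ u) {suc (suc c)} _ (s≤s c<) with as , y , bs , refl , refl ← splitAt u (s≤s z≤n) c< =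
  a ∷ as , y , bs , refl , refl

-- The permutation of [n+1] that agrees with u except that n+1 is put into the cycle of x,
-- right after x: it sends x to n+1 and n+1 to u(x).
extendAfter : ℕ → List ℕ → ℕ → List ℕ
extendAfter n u x = setAt u x (suc n) ++ [ app u x ]

extendFixed : ℕ → List ℕ → List ℕ
extendFixed n u = u ++ [ suc n ]

extensions : ℕ → List ℕ → List (List ℕ)
extensions n u = map (extendAfter n u) (range n) ++ [ extendFixed n u ]

perms : ℕ → List (List ℕ)
perms zero    = [ [] ]
perms (suc n) = concatMap (extensions n) (perms n)

∈-extensions⁻ : ∀ {n u w} → w ∈ extensions n u →
  (Σ[ x ∈ ℕ ] (x ∈ range n × w ≡ extendAfter n u x)) ⊎ w ≡ extendFixed n u
∈-extensions⁻ {n} {u} w∈ with ∈-++⁻ (map (extendAfter n u) (range n)) w∈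
... | inj₁ w∈after       = inj₁ (∈-map⁻ (extendAfter n u) w∈after)
... | inj₂ (here w≡fixed) = inj₂ w≡fixed

extendAfter-mid : ∀ n as y bs → extendAfter n (as ++ y ∷ bs) (suc (length as)) ≡ (as ++ suc n ∷ bs) ++ [ y ]
extendAfter-mid n as y bs rewrite setAt-mid as y bs (suc n) | app-mid as y bs = refl

splitAt-range : ∀ {n u x} → u ↭ range n → x ∈ range n →
  Σ[ as ∈ List ℕ ] Σ[ y ∈ ℕ ] Σ[ bs ∈ List ℕ ] (u ≡ as ++ y ∷ bs × suc (length as) ≡ x)
splitAt-range {u = u} {x} u↭ x∈ with 1≤x , x≤n ← ∈-range⁻ x∈ =
  splitAt u 1≤x (subst (x ≤_) (sym (length-↭-range u↭)) x≤n)

mid-last-swap : ∀ (as : List ℕ) M bs y → (as ++ M ∷ bs) ++ [ y ] ↭ (as ++ y ∷ bs) ++ [ M ]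
mid-last-swap as M bs y = begin
  (as ++ M ∷ bs) ++ [ y ] ≡⟨ ++-assoc as (M ∷ bs) [ y ] ⟩
  as ++ M ∷ bs ++ [ y ]   ↭⟨ shift M as (bs ++ [ y ]) ⟩
  M ∷ as ++ bs ++ [ y ]   ↭⟨ prep M (++⁺ˡ as (↭-sym (∷↭∷ʳ y bs))) ⟩
  M ∷ as ++ y ∷ bs        ↭⟨ ∷↭∷ʳ M (as ++ y ∷ bs) ⟩
  (as ++ y ∷ bs) ++ [ M ] ∎
  where open PermutationReasoning

extendFixed-↭ : ∀ {n u} → u ↭ range n → extendFixed n u ↭ range (suc n)
extendFixed-↭ {n} {u} u↭ = subst (extendFixed n u ↭_) (sym (range-suc n)) (++⁺ʳ [ suc n ] u↭)

extendAfter-↭ : ∀ {n u x} → u ↭ range n → x ∈ range n → extendAfter n u x ↭ range (suc n)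
extendAfter-↭ {n} u↭ x∈ with as , y , bs , refl , refl ← splitAt-range u↭ x∈ rewrite extendAfter-mid n as y bs =
  ↭-trans (mid-last-swap as (suc n) bs y) (extendFixed-↭ u↭)

extensions-↭ : ∀ {n u w} → u ↭ range n → w ∈ extensions n u → w ↭ range (suc n)
extensions-↭ u↭ w∈ with ∈-extensions⁻ w∈
... | inj₁ (x , x∈ , refl) = extendAfter-↭ u↭ x∈
... | inj₂ refl            = extendFixed-↭ u↭

perms-sound : ∀ n {w} → w ∈ perms n → w ↭ range n
perms-sound zero    (here refl) = ↭-refl
perms-sound (suc n) w∈ with u , u∈ , w∈ext ← find (∈-concatMap⁻ (extensions n) {xs = perms n} w∈) =
  extensions-↭ (perms-sound n u∈) w∈ext

suc-∈-range-suc : ∀ n → suc n ∈ range (suc n)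
suc-∈-range-suc n = ∈-range⁺ (s≤s z≤n , ≤-refl)

↭-∷ʳ-max⁻ : ∀ n {u} → u ++ [ suc n ] ↭ range (suc n) → u ↭ range n
↭-∷ʳ-max⁻ n {u} p =
  subst₂ _↭_ (++-identityʳ u) (++-identityʳ (range n)) (drop-mid u (range n) (subst (u ++ [ suc n ] ↭_) (range-suc n) p))

-- If w sends x to n+1 and n+1 to its last entry y, it is the extension after x of the u that
-- sends x to y.
extensions-complete : ∀ n as bs → as ++ suc n ∷ bs ↭ range (suc n) →
  Σ[ u ∈ List ℕ ] (u ↭ range n × as ++ suc n ∷ bs ∈ extensions n u)
extensions-complete n as bs w↭ with initLast bs
... | []       = as , ↭-∷ʳ-max⁻ n w↭ , ∈-++⁺ʳ _ (here refl)
... | bs ∷ʳ′ y = u , u↭ , subst (_∈ extensions n u) w≡ (∈-++⁺ˡ (∈-map⁺ (extendAfter n u) x∈))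
  where
  u = as ++ y ∷ bs
  w≡ : extendAfter n u (suc (length as)) ≡ as ++ suc n ∷ bs ++ [ y ]
  w≡ = trans (extendAfter-mid n as y bs) (++-assoc as (suc n ∷ bs) [ y ])
  u↭ : u ↭ range n
  u↭ = ↭-∷ʳ-max⁻ n (↭-trans (↭-sym (mid-last-swap as (suc n) bs y))
                              (subst (_↭ range (suc n)) (sym (++-assoc as (suc n ∷ bs) [ y ])) w↭))
  x∈ : suc (length as) ∈ range n
  x∈ = ∈-range⁺ (s≤s z≤n , subst (suc (length as) ≤_) length-u (m≤m+n (suc (length as)) (length bs)))
    where
    length-u : suc (length as) + length bs ≡ n
    length-u = trans (sym (+-suc (length as) (length bs))) (trans (sym (length-++ as)) (length-↭-range u↭))

perms-complete : ∀ n {w} → w ↭ range n → w ∈ perms n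
perms-complete zero    w↭ rewrite ↭-empty-inv w↭ = here refl
perms-complete (suc n) w↭
  with as , bs , refl ← ∈-∃++ (∈-resp-↭ (↭-sym w↭) (suc-∈-range-suc n))
  with u , u↭ , w∈ ← extensions-complete n as bs w↭ =
  ∈-concatMap⁺ (extensions n) (lose (perms-complete n u↭) w∈)

replace : ℕ → ℕ → List ℕ → List ℕ
replace M y = map (λ a → if a ≡ᵇ M then y else a)

replace-∉ : ∀ M y l → M ∉ l → replace M y l ≡ l
replace-∉ M y []      _   = refl
replace-∉ M y (a ∷ l) M∉ rewrite ≢⇒≡ᵇ≡false {a} {M} (λ a≡M → M∉ (here (sym a≡M))) =
  cong (a ∷_) (replace-∉ M y l (M∉ ∘ there))

replace-mid : ∀ M y as bs → M ∉ as ++ y ∷ bs → replace M y (as ++ M ∷ bs) ≡ as ++ y ∷ bs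
replace-mid M y []       bs M∉ rewrite ≡⇒≡ᵇ≡true {M} refl = cong (y ∷_) (replace-∉ M y bs (M∉ ∘ there))
replace-mid M y (a ∷ as) bs M∉ rewrite ≢⇒≡ᵇ≡false {a} {M} (λ a≡M → M∉ (here (sym a≡M))) =
  cong (a ∷_) (replace-mid M y as bs (M∉ ∘ there))

dropLast : List ℕ → List ℕ
dropLast []          = []
dropLast (a ∷ [])    = []
dropLast (a ∷ b ∷ u) = a ∷ dropLast (b ∷ u)

lastOr0 : List ℕ → ℕ
lastOr0 []          = 0
lastOr0 (a ∷ [])    = a
lastOr0 (a ∷ b ∷ u) = lastOr0 (b ∷ u)

dropLast-∷ʳ : ∀ u y → dropLast (u ++ [ y ]) ≡ u
dropLast-∷ʳ []          y = refl
dropLast-∷ʳ (a ∷ [])    y = refl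
dropLast-∷ʳ (a ∷ b ∷ u) y = cong (a ∷_) (dropLast-∷ʳ (b ∷ u) y)

lastOr0-∷ʳ : ∀ u y → lastOr0 (u ++ [ y ]) ≡ y
lastOr0-∷ʳ []          y = refl
lastOr0-∷ʳ (a ∷ [])    y = refl
lastOr0-∷ʳ (a ∷ b ∷ u) y = lastOr0-∷ʳ (b ∷ u) y

-- Cuts n+1 out of its cycle: the last entry is the image of n+1, and it becomes the image of
-- the preimage of n+1.
restrict : ℕ → List ℕ → List ℕ
restrict n w = replace (suc n) (lastOr0 w) (dropLast w)

restrict-extensions : ∀ {n u w} → u ↭ range n → w ∈ extensions n u → restrict n w ≡ u
restrict-extensions {n} {u} u↭ w∈ with ∈-extensions⁻ w∈
... | inj₂ refl rewrite dropLast-∷ʳ u (suc n) | lastOr0-∷ʳ u (suc n) =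
  replace-∉ (suc n) (suc n) u (suc-∉-↭-range u↭)
... | inj₁ (x , x∈ , refl) with as , y , bs , refl , refl ← splitAt-range u↭ x∈
  rewrite extendAfter-mid n as y bs | dropLast-∷ʳ (as ++ suc n ∷ bs) y | lastOr0-∷ʳ (as ++ suc n ∷ bs) y =
  replace-mid (suc n) y as bs (suc-∉-↭-range u↭)

module _ {n : ℕ} (u : List ℕ) (u-length : length u ≡ n) where

  app-extendAfter-self : ∀ {x} → InRange n x → app (extendAfter n u x) x ≡ suc n
  app-extendAfter-self {x} (1≤x , x≤n) = trans
    (app-++ˡ (setAt u x (suc n)) _ 1≤x (subst (x ≤_) (sym (trans (length-setAt u x (suc n)) u-length)) x≤n))
    (app-setAt u (suc n) 1≤x (subst (x ≤_) (sym u-length) x≤n))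

  app-extendAfter-≢ : ∀ {x c} → InRange n c → c ≢ x → app (extendAfter n u x) c ≡ app u c
  app-extendAfter-≢ {x} {c} (1≤c , c≤n) c≢x = trans
    (app-++ˡ (setAt u x (suc n)) _ 1≤c (subst (c ≤_) (sym (trans (length-setAt u x (suc n)) u-length)) c≤n))
    (app-setAt-≢ u x (suc n) c c≢x)

  app-extendAfter-new : ∀ x → app (extendAfter n u x) (suc n) ≡ app u x
  app-extendAfter-new x = subst (λ k → app (extendAfter n u x) (suc k) ≡ app u x)
    (trans (length-setAt u x (suc n)) u-length) (app-mid (setAt u x (suc n)) (app u x) [])

  app-extendFixed-old : ∀ {c} → InRange n c → app (extendFixed n u) c ≡ app u c
  app-extendFixed-old {c} (1≤c , c≤n) = app-++ˡ u _ 1≤c (subst (c ≤_) (sym u-length) c≤n)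

  app-extendFixed-new : app (extendFixed n u) (suc n) ≡ suc n
  app-extendFixed-new = subst (λ k → app (extendFixed n u) (suc k) ≡ suc n) u-length (app-mid u (suc n) [])

app-∈-↭-range : ∀ {n u c} → u ↭ range n → InRange n c → app u c ∈ u
app-∈-↭-range {u = u} {c} u↭ (1≤c , c≤n) = app-∈ u 1≤c (subst (c ≤_) (sym (length-↭-range u↭)) c≤n)

app-↭-range : ∀ {n u c} → u ↭ range n → InRange n c → InRange n (app u c)
app-↭-range u↭ c∈ = ∈-range⁻ (∈-resp-↭ u↭ (app-∈-↭-range u↭ c∈))

-- Distinct extensions already differ at x: the one after x maps x to n+1, which u never does.
Unique-extensions : ∀ {n u} → u ↭ range n → Unique (extensions n u)
Unique-extensions {n} {u} u↭ = ++⁺ (Unique-map⁺-injectiveOn (extendAfter n u) injective (Unique-range n)) ([] ∷ []) disjoint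
  where
  u-length = length-↭-range u↭
  absurd : ∀ {x} → x ∈ range n → app u x ≡ suc n → ⊥
  absurd x∈ eq = suc-∉-↭-range u↭ (subst (_∈ u) eq (app-∈-↭-range u↭ (∈-range⁻ x∈)))
  injective : ∀ {x y} → x ∈ range n → y ∈ range n → extendAfter n u x ≡ extendAfter n u y → x ≡ y
  injective {x} {y} x∈ _ eq with x ≟ y
  ... | yes x≡y = x≡y
  ... | no  x≢y = ⊥-elim (absurd x∈ (begin
    app u x                     ≡⟨ app-extendAfter-≢ u u-length (∈-range⁻ x∈) x≢y ⟨
    app (extendAfter n u y) x   ≡⟨ cong (λ w → app w x) eq ⟨
    app (extendAfter n u x) x   ≡⟨ app-extendAfter-self u u-length (∈-range⁻ x∈) ⟩
    suc n                       ∎))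
    where open ≡-Reasoning
  disjoint : ∀ {w} → w ∈ map (extendAfter n u) (range n) × w ∈ [ extendFixed n u ] → ⊥
  disjoint (w∈ , here refl) with x , x∈ , eq ← ∈-map⁻ (extendAfter n u) w∈ = absurd x∈ (begin
    app u x                     ≡⟨ app-extendFixed-old u u-length (∈-range⁻ x∈) ⟨
    app (extendFixed n u) x     ≡⟨ cong (λ w → app w x) eq ⟩
    app (extendAfter n u x) x   ≡⟨ app-extendAfter-self u u-length (∈-range⁻ x∈) ⟩
    suc n                       ∎)
    where open ≡-Reasoning

Unique-perms : ∀ n → Unique (perms n)
Unique-perms zero    = [] ∷ []
Unique-perms (suc n) = Unique-concatMap⁺ (extensions n) (restrict n)
  (λ u∈ → restrict-extensions (perms-sound n u∈)) (λ u∈ → Unique-extensions (perms-sound n u∈)) (Unique-perms n)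

↭-perms : ∀ n {Sn} → Unique Sn → (∀ w → (w ∈ Sn) ⇔ (w ↭ range n)) → Sn ↭ perms n
↭-perms n Sn! Sn⇔ = Unique-sameMembers⇒↭ Sn! (Unique-perms n)
  (λ {w} w∈ → perms-complete n (Equivalence.to (Sn⇔ w) w∈)) (λ {w} w∈ → Equivalence.from (Sn⇔ w) (perms-sound n w∈))

-- Cycle forms along the enumeration

data Orbit (w : List ℕ) (s : ℕ) : ℕ → List ℕ → Set where
  last : ∀ {c} → app w c ≡ s → Orbit w s c [ c ]
  next : ∀ {c d l} → app w c ≡ d → d ≢ s → Orbit w s d l → Orbit w s c (c ∷ l)

cycleFrom-Orbit : ∀ {w s c l K} → Orbit w s c l → length l ≤ K → cycleFrom K w s c ≡ l
cycleFrom-Orbit {K = suc K} (last w[c]≡s) _ rewrite ≡⇒≡ᵇ≡true w[c]≡s = refl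
cycleFrom-Orbit {c = c} {K = suc K} (next refl d≢s orb) (s≤s l≤K) rewrite ≢⇒≡ᵇ≡false d≢s =
  cong (c ∷_) (cycleFrom-Orbit orb l≤K)

cycleOf-Orbit : ∀ {w s l} → Orbit w s s l → length l ≤ length w → cycleOf w s ≡ l
cycleOf-Orbit = cycleFrom-Orbit

Orbit-inRange : ∀ {n u s c l} → u ↭ range n → Orbit u s c l → InRange n c → All (InRange n) l
Orbit-inRange u↭ (last _)           c∈ = c∈ ∷ []
Orbit-inRange u↭ (next refl _ orb) c∈ = c∈ ∷ Orbit-inRange u↭ orb (app-↭-range u↭ c∈)

expandAt : ℕ → ℕ → ℕ → List ℕ
expandAt x M c = c ∷ (if c ≡ᵇ x then [ M ] else [])

insertAfter : ℕ → ℕ → List ℕ → List ℕ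
insertAfter x M = concatMap (expandAt x M)

module _ {x M : ℕ} where

  insertAfter-++ : ∀ a b → insertAfter x M (a ++ b) ≡ insertAfter x M a ++ insertAfter x M b
  insertAfter-++ = concatMap-++ (expandAt x M)

  insertAfter-∷-≡ : ∀ l → insertAfter x M (x ∷ l) ≡ x ∷ M ∷ insertAfter x M l
  insertAfter-∷-≡ l rewrite ≡⇒≡ᵇ≡true {x} refl = refl

  insertAfter-∷-≢ : ∀ {c} l → c ≢ x → insertAfter x M (c ∷ l) ≡ c ∷ insertAfter x M l
  insertAfter-∷-≢ l c≢x rewrite ≢⇒≡ᵇ≡false c≢x = refl

  insertAfter-∉ : ∀ {l} → x ∉ l → insertAfter x M l ≡ l
  insertAfter-∉ {[]}    _  = refl
  insertAfter-∉ {c ∷ l} x∉ =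
    trans (insertAfter-∷-≢ l (λ c≡x → x∉ (here (sym c≡x)))) (cong (c ∷_) (insertAfter-∉ (x∉ ∘ there)))

  ∈-insertAfter⁺ : ∀ {z l} → z ∈ l → z ∈ insertAfter x M l
  ∈-insertAfter⁺ z∈ = ∈-concatMap⁺ (expandAt x M) (Any.map here z∈)

  ∈-insertAfter⁻ : ∀ {z l} → z ∈ insertAfter x M l → z ∈ l ⊎ z ≡ M
  ∈-insertAfter⁻ z∈ with c , c∈ , z∈expand ← find (∈-concatMap⁻ (expandAt x M) z∈) = expand⁻ c∈ z∈expand
    where
    expand⁻ : ∀ {z c l} → c ∈ l → z ∈ expandAt x M c → z ∈ l ⊎ z ≡ M
    expand⁻ {c = c} c∈ (here refl) = inj₁ c∈
    expand⁻ {c = c} c∈ (there z∈) with c ≡ᵇ x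
    expand⁻ c∈ (there (here refl)) | true = inj₂ refl

  M∈insertAfter : ∀ {l} → x ∈ l → M ∈ insertAfter x M l
  M∈insertAfter x∈ = ∈-concatMap⁺ (expandAt x M) (Any.map (λ { refl → M∈expandAt }) x∈)
    where
    M∈expandAt : M ∈ expandAt x M x
    M∈expandAt rewrite ≡⇒≡ᵇ≡true {x} refl = there (here refl)

  insertAfter-mid : ∀ as bs → x ∉ as → x ∉ bs → insertAfter x M (as ++ x ∷ bs) ≡ as ++ x ∷ M ∷ bs
  insertAfter-mid as bs x∉as x∉bs = begin
    insertAfter x M (as ++ x ∷ bs)              ≡⟨ insertAfter-++ as (x ∷ bs) ⟩
    insertAfter x M as ++ insertAfter x M (x ∷ bs) ≡⟨ cong₂ _++_ (insertAfter-∉ x∉as) (insertAfter-∷-≡ bs) ⟩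
    as ++ x ∷ M ∷ insertAfter x M bs            ≡⟨ cong (λ l → as ++ x ∷ M ∷ l) (insertAfter-∉ x∉bs) ⟩
    as ++ x ∷ M ∷ bs                            ∎
    where open ≡-Reasoning

  insertAfter-↭ : ∀ {l} → Unique l → x ∈ l → insertAfter x M l ↭ M ∷ l
  insertAfter-↭ l! x∈ with as , bs , refl ← ∈-∃++ x∈ = begin
    insertAfter x M (as ++ x ∷ bs) ≡⟨ insertAfter-mid as bs (x∉as++bs ∘ ∈-++⁺ˡ) (x∉as++bs ∘ ∈-++⁺ʳ as) ⟩
    as ++ x ∷ M ∷ bs               ↭⟨ ++⁺ˡ as (swap x M ↭-refl) ⟩
    as ++ M ∷ x ∷ bs               ↭⟨ shift M as (x ∷ bs) ⟩
    M ∷ as ++ x ∷ bs               ∎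
    where
    open PermutationReasoning
    x∉as++bs : x ∉ as ++ bs
    x∉as++bs = Unique[x∷xs]⇒x∉xs (Unique-resp-↭ (shift x as bs) l!)

  Unique-insertAfter : ∀ {l} → M ∉ l → Unique l → Unique (insertAfter x M l)
  Unique-insertAfter {l} M∉ l! with x ∈? l
  ... | yes x∈ = Unique-resp-↭ (↭-sym (insertAfter-↭ l! x∈)) (Unique-∷ M∉ l!)
  ... | no  x∉ = subst Unique (sym (insertAfter-∉ x∉)) l!

  length-insertAfter : ∀ {l} → Unique l → length (insertAfter x M l) ≤ suc (length l)
  length-insertAfter {l} l! with x ∈? l
  ... | yes x∈ = ≤-reflexive (↭-length (insertAfter-↭ l! x∈))
  ... | no  x∉ = subst (λ k → length k ≤ suc (length l)) (sym (insertAfter-∉ x∉)) (n≤1+n (length l))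

map-insertAfter≡insertions : ∀ M v → Unique v → map (λ y → insertAfter y M v) v ≡ insertions M v
map-insertAfter≡insertions M []      _             = refl
map-insertAfter≡insertions M (a ∷ v) a∷v!@(a≢v ∷ v!) = cong₂ _∷_
  (trans (insertAfter-∷-≡ v) (cong (λ l → a ∷ M ∷ l) (insertAfter-∉ (Unique[x∷xs]⇒x∉xs a∷v!))))
  (begin
    map (λ y → insertAfter y M (a ∷ v)) v
      ≡⟨ map-cong-local (All.tabulate (λ y∈ → insertAfter-∷-≢ v (All.lookup a≢v y∈))) ⟩
    map (λ y → a ∷ insertAfter y M v) v   ≡⟨ map-∘ v ⟩
    map (a ∷_) (map (λ y → insertAfter y M v) v) ≡⟨ cong (map (a ∷_)) (map-insertAfter≡insertions M v v!) ⟩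
    map (a ∷_) (insertions M v)           ∎)
  where open ≡-Reasoning

seenAfter : List ℕ → List ℕ → List ℕ → List ℕ
seenAfter w []       seen = seen
seenAfter w (i ∷ is) seen = if elem i seen then seenAfter w is seen else seenAfter w is (cycleOf w i ++ seen)

flattenGo-++ : ∀ w xs ys s → flattenGo w (xs ++ ys) s ≡ flattenGo w xs s ++ flattenGo w ys (seenAfter w xs s)
flattenGo-++ w []       ys s = refl
flattenGo-++ w (i ∷ xs) ys s with elem i s
... | true  = flattenGo-++ w xs ys s
... | false = trans (cong (cycleOf w i ++_) (flattenGo-++ w xs ys (cycleOf w i ++ s)))
                    (sym (++-assoc (cycleOf w i) _ _))

seenAfter-⊇ : ∀ w xs s {z} → z ∈ s → z ∈ seenAfter w xs s
seenAfter-⊇ w []       s z∈ = z∈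
seenAfter-⊇ w (i ∷ xs) s z∈ with elem i s
... | true  = seenAfter-⊇ w xs s z∈
... | false = seenAfter-⊇ w xs _ (∈-++⁺ʳ (cycleOf w i) z∈)

∈-cycleOf : ∀ w i → 1 ≤ length w → i ∈ cycleOf w i
∈-cycleOf w i 1≤|w| with length w
... | suc _ = here refl

∈-seenAfter : ∀ w xs s {i} → 1 ≤ length w → i ∈ xs → i ∈ seenAfter w xs s
∈-seenAfter w (j ∷ xs) s 1≤|w| (here refl) with elem j s in eq
... | true  = seenAfter-⊇ w xs s (Equivalence.to elem≡true⇔∈ eq)
... | false = seenAfter-⊇ w xs _ (∈-++⁺ˡ (∈-cycleOf w j 1≤|w|))
∈-seenAfter w (j ∷ xs) s 1≤|w| (there i∈) with elem j s
... | true  = ∈-seenAfter w xs s 1≤|w| i∈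
... | false = ∈-seenAfter w xs _ 1≤|w| i∈

All-seenAfter : ∀ w (Q : ℕ → Set) → (∀ {i} → Q i → All Q (cycleOf w i)) →
  ∀ xs s → All Q xs → All Q s → All Q (seenAfter w xs s)
All-seenAfter w Q cycle-Q []       s _              s-Q = s-Q
All-seenAfter w Q cycle-Q (i ∷ xs) s (i-Q ∷ xs-Q) s-Q with elem i s
... | true  = All-seenAfter w Q cycle-Q xs s xs-Q s-Q
... | false = All-seenAfter w Q cycle-Q xs _ xs-Q (All-++⁺ (cycle-Q i-Q) s-Q)

-- If, on the scanned elements, the cycles of w are the F-images of those of u and F does not
-- change which of them were seen, then the scans of u and w proceed in lockstep.
module _ (w u : List ℕ) (F : List ℕ → List ℕ) (Q : ℕ → Set)
  (F-[] : F [] ≡ []) (F-++ : ∀ a b → F (a ++ b) ≡ F a ++ F b)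
  (elem-F : ∀ {i} s → Q i → elem i (F s) ≡ elem i s)
  (cycleOf-F : ∀ {i} → Q i → cycleOf w i ≡ F (cycleOf u i)) where

  flattenGo-F : ∀ xs s → All Q xs →
    flattenGo w xs (F s) ≡ F (flattenGo u xs s) × seenAfter w xs (F s) ≡ F (seenAfter u xs s)
  flattenGo-F []       s _            = sym F-[] , refl
  flattenGo-F (i ∷ xs) s (i-Q ∷ xs-Q) rewrite elem-F s i-Q with elem i s
  ... | true  = flattenGo-F xs s xs-Q
  ... | false rewrite cycleOf-F i-Q | sym (F-++ (cycleOf u i) s) =
    trans (cong (F (cycleOf u i) ++_) (proj₁ IH)) (sym (F-++ _ _)) , proj₂ IH
    where IH = flattenGo-F xs (cycleOf u i ++ s) xs-Q

inRange-suc⁻ : ∀ {n s} → InRange (suc n) s → InRange n s ⊎ s ≡ suc n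
inRange-suc⁻ (1≤s , s≤1+n) with m≤n⇒m<n∨m≡n s≤1+n
... | inj₁ s<1+n = inj₁ (1≤s , ≤-pred s<1+n)
... | inj₂ s≡1+n = inj₂ s≡1+n

inRange⇒≢suc : ∀ {n c} → InRange n c → c ≢ suc n
inRange⇒≢suc (_ , c≤n) refl = 1+n≰n c≤n

Orbit-head : ∀ {w s c l} → Orbit w s c l → Σ[ l′ ∈ List ℕ ] l ≡ c ∷ l′
Orbit-head (last _)     = [] , refl
Orbit-head (next _ _ _) = _ , refl

Flatten-suc : ∀ {n} w → length w ≡ suc n →
  Flatten w ≡ flattenGo w (range n) [] ++ flattenGo w [ suc n ] (seenAfter w (range n) [])
Flatten-suc {n} w w-length = begin
  flattenGo w (range (length w)) []     ≡⟨ cong (λ k → flattenGo w (range k) []) w-length ⟩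
  flattenGo w (range (suc n)) []        ≡⟨ cong (λ r → flattenGo w r []) (range-suc n) ⟩
  flattenGo w (range n ++ [ suc n ]) [] ≡⟨ flattenGo-++ w (range n) [ suc n ] [] ⟩
  flattenGo w (range n) [] ++ flattenGo w [ suc n ] (seenAfter w (range n) []) ∎
  where open ≡-Reasoning

record PermInvariant (n : ℕ) (u : List ℕ) : Set where
  field
    perm         : u ↭ range n
    orbit        : ∀ {s} → InRange n s → Σ[ l ∈ List ℕ ] (Orbit u s s l × Unique l × length l ≤ n)
    flatten-perm : Flatten u ↭ range n
    flatten-head : Flatten u ≡ [] ⊎ Σ[ r ∈ List ℕ ] Flatten u ≡ 1 ∷ r

  u-length : length u ≡ n
  u-length = length-↭-range perm

  Flatten≡flattenGo : Flatten u ≡ flattenGo u (range n) []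
  Flatten≡flattenGo = cong (λ k → flattenGo u (range k) []) u-length

  cycleOf-orbit : ∀ {s} → InRange n s → Σ[ l ∈ List ℕ ] (Orbit u s s l × Unique l × length l ≤ n × cycleOf u s ≡ l)
  cycleOf-orbit s∈ with l , orb , l! , l≤n ← orbit s∈ =
    l , orb , l! , l≤n , cycleOf-Orbit orb (subst (length l ≤_) (sym u-length) l≤n)

PermInvariant-[] : PermInvariant 0 []
PermInvariant-[] = record
  { perm         = ↭-refl
  ; orbit        = λ (1≤s , s≤0) → ⊥-elim (1+n≰n (≤-trans 1≤s s≤0))
  ; flatten-perm = ↭-refl
  ; flatten-head = inj₁ refl
  }

module ExtendAfter {n u x} (inv : PermInvariant n u) (x∈ : x ∈ range n) where
  open PermInvariant inv

  private
    M = suc n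
    w = extendAfter n u x
    x-inRange = ∈-range⁻ x∈

    w-length : length w ≡ M
    w-length = trans (length-++ (setAt u x M)) (trans (cong (_+ 1) (trans (length-setAt u x M) u-length)) (+-comm n 1))

  orbit-old : ∀ {s c l} → InRange n s → InRange n c → Orbit u s c l → Orbit w s c (insertAfter x M l)
  orbit-old {s} {c} s∈ c∈ (last u[c]≡s) with c ≟ x
  ... | yes refl = subst (Orbit w s c) (sym (insertAfter-∷-≡ []))
                     (next (app-extendAfter-self u u-length c∈) (inRange⇒≢suc s∈ ∘ sym)
                       (last (trans (app-extendAfter-new u u-length c) u[c]≡s)))
  ... | no  c≢x = subst (Orbit w s c) (sym (insertAfter-∷-≢ [] c≢x))
                        (last (trans (app-extendAfter-≢ u u-length c∈ c≢x) u[c]≡s))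
  orbit-old {s} {c} s∈ c∈ (next {l = l} refl d≢s orb) with c ≟ x
  ... | yes refl = subst (Orbit w s c) (sym (insertAfter-∷-≡ l))
                     (next (app-extendAfter-self u u-length c∈) (inRange⇒≢suc s∈ ∘ sym)
                       (next (app-extendAfter-new u u-length c) d≢s (orbit-old s∈ (app-↭-range perm c∈) orb)))
  ... | no  c≢x = subst (Orbit w s c) (sym (insertAfter-∷-≢ l c≢x))
                    (next (app-extendAfter-≢ u u-length c∈ c≢x) d≢s (orbit-old s∈ (app-↭-range perm c∈) orb))

  orbit-new : ∀ {c l} → InRange n c → x ∉ l → Orbit u x c l → Orbit w M c (l ++ [ x ])
  orbit-new c∈ x∉ (last u[c]≡x) =
    next (trans (app-extendAfter-≢ u u-length c∈ (x∉ ∘ here ∘ sym)) u[c]≡x) (inRange⇒≢suc x-inRange)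
      (last (app-extendAfter-self u u-length x-inRange))
  orbit-new c∈ x∉ (next refl d≢x orb) =
    next (app-extendAfter-≢ u u-length c∈ (x∉ ∘ here ∘ sym)) (inRange⇒≢suc (app-↭-range perm c∈))
      (orbit-new (app-↭-range perm c∈) (x∉ ∘ there) orb)

  orbit-M : ∀ {l} → x ∉ l → Orbit u x x (x ∷ l) → Orbit w M M (M ∷ l ++ [ x ])
  orbit-M _  (last u[x]≡x)  = next (trans (app-extendAfter-new u u-length x) u[x]≡x) (inRange⇒≢suc x-inRange)
                                   (last (app-extendAfter-self u u-length x-inRange))
  orbit-M x∉ (next refl _ orb) = next (app-extendAfter-new u u-length x) (inRange⇒≢suc (app-↭-range perm x-inRange))
                                   (orbit-new (app-↭-range perm x-inRange) x∉ orb)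

  orbit′ : ∀ {s} → InRange M s → Σ[ l ∈ List ℕ ] (Orbit w s s l × Unique l × length l ≤ M)
  orbit′ s∈ with inRange-suc⁻ s∈
  ... | inj₁ s∈n with l , orb , l! , l≤n ← orbit s∈n =
    insertAfter x M l , orbit-old s∈n s∈n orb ,
    Unique-insertAfter (λ M∈ → inRange⇒≢suc (All.lookup (Orbit-inRange perm orb s∈n) M∈) refl) l! ,
    ≤-trans (length-insertAfter l!) (s≤s l≤n)
  ... | inj₂ refl
    with l₀ , orb , l₀! , l₀≤n ← orbit x-inRange
    with l , refl ← Orbit-head orb =
    M ∷ l ++ [ x ] , orbit-M (Unique[x∷xs]⇒x∉xs l₀!) orb ,
    Unique-∷ M∉ (Unique-resp-↭ (∷↭∷ʳ x l) l₀!) ,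
    s≤s (subst (_≤ n) (↭-length (∷↭∷ʳ x l)) l₀≤n)
    where
    M∉ : M ∉ l ++ [ x ]
    M∉ M∈ = inRange⇒≢suc (All.lookup (Orbit-inRange perm orb x-inRange) (∈-resp-↭ (↭-sym (∷↭∷ʳ x l)) M∈)) refl

  Flatten-extendAfter : Flatten w ≡ insertAfter x M (Flatten u)
  Flatten-extendAfter = begin
      Flatten w
    ≡⟨ Flatten-suc w w-length ⟩
      flattenGo w (range n) [] ++ flattenGo w [ M ] (seenAfter w (range n) [])
    ≡⟨ cong₂ (λ a b → a ++ flattenGo w [ M ] b) (proj₁ lockstep) (proj₂ lockstep) ⟩
      insertAfter x M (flattenGo u (range n) []) ++ flattenGo w [ M ] (insertAfter x M seen)
    ≡⟨ cong (insertAfter x M (flattenGo u (range n) []) ++_) M-seen ⟩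
      insertAfter x M (flattenGo u (range n) []) ++ []
    ≡⟨ ++-identityʳ _ ⟩
      insertAfter x M (flattenGo u (range n) [])
    ≡⟨ cong (insertAfter x M) Flatten≡flattenGo ⟨
      insertAfter x M (Flatten u)
    ∎
    where
    open ≡-Reasoning
    seen = seenAfter u (range n) []
    elem-insertAfter : ∀ {i} s → InRange n i → elem i (insertAfter x M s) ≡ elem i s
    elem-insertAfter {i} s i∈ = elem-cong {i} {insertAfter x M s} {s}
      ([ (λ i∈s → i∈s) , (λ { refl → ⊥-elim (inRange⇒≢suc i∈ refl) }) ]′ ∘ ∈-insertAfter⁻ {x} {M})
      (∈-insertAfter⁺ {x} {M})
    cycleOf-insertAfter : ∀ {i} → InRange n i → cycleOf w i ≡ insertAfter x M (cycleOf u i)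
    cycleOf-insertAfter i∈ with l , orb , l! , l≤n , cycle≡l ← cycleOf-orbit i∈ =
      trans (cycleOf-Orbit (orbit-old i∈ i∈ orb) (subst (length (insertAfter x M l) ≤_) (sym w-length) l′≤))
            (cong (insertAfter x M) (sym cycle≡l))
      where l′≤ = ≤-trans (length-insertAfter l!) (s≤s l≤n)
    lockstep = flattenGo-F w u (insertAfter x M) (InRange n) refl insertAfter-++ elem-insertAfter cycleOf-insertAfter
                 (range n) [] (All.tabulate ∈-range⁻)
    M-seen : flattenGo w [ M ] (insertAfter x M seen) ≡ []
    M-seen = cong (λ b → if b then [] else cycleOf w M ++ [])
      (Equivalence.from elem≡true⇔∈ (M∈insertAfter (∈-seenAfter u (range n) [] 1≤length x∈)))
      where 1≤length = subst (1 ≤_) (sym u-length) (≤-trans (proj₁ x-inRange) (proj₂ x-inRange))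

  invariant : PermInvariant M w
  invariant = record
    { perm         = extendAfter-↭ perm x∈
    ; orbit        = orbit′
    ; flatten-perm = subst (_↭ range M) (sym Flatten-extendAfter)
                       (↭-trans inserted↭ (subst (M ∷ Flatten u ↭_) (sym (range-suc n)) M∷v↭))
    ; flatten-head = subst (λ v → v ≡ [] ⊎ Σ[ r ∈ List ℕ ] v ≡ 1 ∷ r) (sym Flatten-extendAfter) head′
    }
    where
    inserted↭ : insertAfter x M (Flatten u) ↭ M ∷ Flatten u
    inserted↭ = insertAfter-↭ (Unique-resp-↭ (↭-sym flatten-perm) (Unique-range n)) (∈-resp-↭ (↭-sym flatten-perm) x∈)
    M∷v↭ : M ∷ Flatten u ↭ range n ++ [ M ]
    M∷v↭ = ↭-trans (∷↭∷ʳ M (Flatten u)) (++⁺ʳ [ M ] flatten-perm)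
    head′ : insertAfter x M (Flatten u) ≡ [] ⊎ Σ[ r ∈ List ℕ ] insertAfter x M (Flatten u) ≡ 1 ∷ r
    head′ with Flatten u | flatten-head
    ... | _ | inj₁ refl       = inj₁ refl
    ... | _ | inj₂ (r , refl) = inj₂ (_ , refl)

module ExtendFixed {n u} (inv : PermInvariant n u) where
  open PermInvariant inv

  private
    M = suc n
    w = extendFixed n u

    w-length : length w ≡ M
    w-length = trans (length-++ u) (trans (cong (_+ 1) u-length) (+-comm n 1))

  orbit-old : ∀ {s c l} → InRange n c → Orbit u s c l → Orbit w s c l
  orbit-old c∈ (last u[c]≡s)       = last (trans (app-extendFixed-old u u-length c∈) u[c]≡s)
  orbit-old c∈ (next refl d≢s orb) = next (app-extendFixed-old u u-length c∈) d≢s (orbit-old (app-↭-range perm c∈) orb)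

  orbit′ : ∀ {s} → InRange M s → Σ[ l ∈ List ℕ ] (Orbit w s s l × Unique l × length l ≤ M)
  orbit′ s∈ with inRange-suc⁻ s∈
  ... | inj₁ s∈n with l , orb , l! , l≤n ← orbit s∈n = l , orbit-old s∈n orb , l! , m≤n⇒m≤1+n l≤n
  ... | inj₂ refl = [ M ] , last (app-extendFixed-new u u-length) , [] ∷ [] , s≤s z≤n

  Flatten-extendFixed : Flatten w ≡ Flatten u ++ [ M ]
  Flatten-extendFixed = begin
      Flatten w
    ≡⟨ Flatten-suc w w-length ⟩
      flattenGo w (range n) [] ++ flattenGo w [ M ] (seenAfter w (range n) [])
    ≡⟨ cong₂ (λ a b → a ++ flattenGo w [ M ] b) (proj₁ lockstep) (proj₂ lockstep) ⟩
      flattenGo u (range n) [] ++ flattenGo w [ M ] seen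
    ≡⟨ cong₂ _++_ (sym Flatten≡flattenGo) M-unseen ⟩
      Flatten u ++ [ M ]
    ∎
    where
    open ≡-Reasoning
    seen = seenAfter u (range n) []
    cycleOf-old : ∀ {i} → InRange n i → cycleOf w i ≡ cycleOf u i
    cycleOf-old i∈ with l , orb , l! , l≤n , cycle≡l ← cycleOf-orbit i∈ =
      trans (cycleOf-Orbit (orbit-old i∈ orb) (subst (length l ≤_) (sym w-length) (m≤n⇒m≤1+n l≤n))) (sym cycle≡l)
    lockstep = flattenGo-F w u (λ l → l) (InRange n) refl (λ _ _ → refl) (λ _ _ → refl) cycleOf-old
                 (range n) [] (All.tabulate ∈-range⁻)
    seen-inRange : All (InRange n) seen
    seen-inRange = All-seenAfter u (InRange n) cycle-inRange (range n) [] (All.tabulate ∈-range⁻) []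
      where
      cycle-inRange : ∀ {i} → InRange n i → All (InRange n) (cycleOf u i)
      cycle-inRange i∈ with l , orb , _ , _ , cycle≡l ← cycleOf-orbit i∈ =
        subst (All (InRange n)) (sym cycle≡l) (Orbit-inRange perm orb i∈)
    M-unseen : flattenGo w [ M ] seen ≡ [ M ]
    M-unseen = cong₂ (λ b c → if b then [] else c ++ [])
      (∉⇒elem≡false (λ M∈ → inRange⇒≢suc (All.lookup seen-inRange M∈) refl))
      (cycleOf-Orbit (last (app-extendFixed-new u u-length)) (subst (1 ≤_) (sym w-length) (s≤s z≤n)))

  invariant : PermInvariant M w
  invariant = record
    { perm         = extendFixed-↭ perm
    ; orbit        = orbit′
    ; flatten-perm = subst (_↭ range M) (sym Flatten-extendFixed) (extendFixed-↭ flatten-perm)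
    ; flatten-head = inj₂ (subst (λ v → Σ[ r ∈ List ℕ ] v ≡ 1 ∷ r) (sym Flatten-extendFixed) head′)
    }
    where
    -- Flatten u is empty only for n = 0, where Flatten w = [ 1 ].
    head′ : Σ[ r ∈ List ℕ ] Flatten u ++ [ M ] ≡ 1 ∷ r
    head′ with Flatten u | flatten-head | flatten-perm
    ... | _ | inj₂ (r , refl) | _  = r ++ [ M ] , refl
    ... | _ | inj₁ refl       | v↭ with refl ← trans (sym (length-range n)) (sym (↭-length v↭)) = [] , refl

PermInvariant-perms : ∀ n {u} → u ∈ perms n → PermInvariant n u
PermInvariant-perms zero    (here refl) = PermInvariant-[]
PermInvariant-perms (suc n) w∈ with u , u∈ , w∈ext ← find (∈-concatMap⁻ (extensions n) {xs = perms n} w∈)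
  with ∈-extensions⁻ w∈ext
... | inj₁ (x , x∈ , refl) = ExtendAfter.invariant (PermInvariant-perms n u∈) x∈
... | inj₂ refl            = ExtendFixed.invariant (PermInvariant-perms n u∈)

-- Totals over all permutations

module CountExtensions {n u} (inv : PermInvariant n u) where
  open PermInvariant inv

  private
    M = suc n
    v = Flatten u

    v-inRange : All (InRange n) v
    v-inRange = All.tabulate (∈-range⁻ ∘ ∈-resp-↭ flatten-perm)

    v<M : All (_< M) v
    v<M = All.map (s≤s ∘ proj₂) v-inRange

    v-length : length v ≡ n
    v-length = length-↭-range flatten-perm

    headDescent-v : headDescent v ≡ 0
    headDescent-v with v | flatten-head | v-inRange
    ... | _ | inj₁ refl            | _                 = refl
    ... | _ | inj₂ ([] , refl)     | _                 = refl
    ... | _ | inj₂ (b ∷ _ , refl) | _ ∷ (1≤b , _) ∷ _ with suc _ ← b = refl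

  sum-extensions : ∀ (h : List ℕ → ℕ) →
    sum (map (h ∘ Flatten) (extensions n u)) ≡ sum (map h (insertions M v)) + h (v ++ [ M ])
  sum-extensions h = begin
      sum (map (h ∘ Flatten) (map (extendAfter n u) (range n) ++ [ extendFixed n u ]))
    ≡⟨ cong sum (map-++ (h ∘ Flatten) (map (extendAfter n u) (range n)) _) ⟩
      sum (map (h ∘ Flatten) (map (extendAfter n u) (range n)) ++ [ h (Flatten (extendFixed n u)) ])
    ≡⟨ sum-++ (map (h ∘ Flatten) (map (extendAfter n u) (range n))) _ ⟩
      sum (map (h ∘ Flatten) (map (extendAfter n u) (range n))) + (h (Flatten (extendFixed n u)) + 0)
    ≡⟨ cong₂ _+_ (cong sum (sym (map-∘ (range n)))) (trans (+-identityʳ _) (cong h (ExtendFixed.Flatten-extendFixed inv))) ⟩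
      sum (map (λ x → h (Flatten (extendAfter n u x))) (range n)) + h (v ++ [ M ])
    ≡⟨ cong (_+ h (v ++ [ M ])) (begin
        sum (map (λ x → h (Flatten (extendAfter n u x))) (range n))
      ≡⟨ sum-map-cong-∈ _ _ (range n) (cong h ∘ ExtendAfter.Flatten-extendAfter inv) ⟩
        sum (map (λ x → h (insertAfter x M v)) (range n))
      ≡⟨ sum-↭ (↭-map⁺ (λ x → h (insertAfter x M v)) (↭-sym flatten-perm)) ⟩
        sum (map (λ x → h (insertAfter x M v)) v)
      ≡⟨ cong sum (map-∘ v) ⟩
        sum (map h (map (λ x → insertAfter x M v) v))
      ≡⟨ cong (sum ∘ map h) (map-insertAfter≡insertions M v (Unique-resp-↭ (↭-sym flatten-perm) (Unique-range n))) ⟩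
        sum (map h (insertions M v))
      ∎) ⟩
      sum (map h (insertions M v)) + h (v ++ [ M ])
    ∎
    where open ≡-Reasoning

  occ321-extensions : sum (map (occ321 ∘ Flatten) (extensions n u)) + occ321 v ≡ n * occ321 v + descents v
  occ321-extensions = begin
      sum (map (occ321 ∘ Flatten) (extensions n u)) + occ321 v
    ≡⟨ cong (_+ occ321 v) (sum-extensions occ321) ⟩
      Σ + occ321 (v ++ [ M ]) + occ321 v
    ≡⟨ cong (λ z → Σ + z + occ321 v) (occ321-∷ʳ-max v v<M) ⟩
      Σ + occ321 v + occ321 v
    ≡⟨ double Σ (occ321 v) ⟩
      Σ + 2 * occ321 v + 0
    ≡⟨ cong (Σ + 2 * occ321 v +_) (sym headDescent-v) ⟩
      Σ + 2 * occ321 v + headDescent v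
    ≡⟨ occ321-insertions v v<M ⟩
      length v * occ321 v + descents v
    ≡⟨ cong (λ k → k * occ321 v + descents v) v-length ⟩
      n * occ321 v + descents v
    ∎
    where
    open ≡-Reasoning
    Σ = sum (map occ321 (insertions M v))
    double : ∀ s o → s + o + o ≡ s + 2 * o + 0
    double = solve-∀

  descents-extensions : 1 ≤ n → sum (map (descents ∘ Flatten) (extensions n u)) + 1 ≡ n * descents v + n
  descents-extensions 1≤n with v | v<M | v-length | sum-extensions descents
  ... | [] | _ | refl | _ with () ← 1≤n
  ... | a ∷ v′ | a∷v′<M | refl | sum-ext = begin
      sum (map (descents ∘ Flatten) (extensions n u)) + 1
    ≡⟨ cong (_+ 1) sum-ext ⟩
      sum (map descents (insertions M (a ∷ v′))) + descents ((a ∷ v′) ++ [ M ]) + 1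
    ≡⟨ cong (λ z → sum (map descents (insertions M (a ∷ v′))) + z + 1) (descents-∷ʳ-max (a ∷ v′) a∷v′<M) ⟩
      sum (map descents (insertions M (a ∷ v′))) + descents (a ∷ v′) + 1
    ≡⟨ descents-insertions a v′ a∷v′<M ⟩
      suc (length v′) * descents (a ∷ v′) + suc (length v′)
    ∎
    where open ≡-Reasoning

occ321Total : ℕ → ℕ
occ321Total n = sum (map (occ321 ∘ Flatten) (perms n))

descentTotal : ℕ → ℕ
descentTotal n = sum (map (descents ∘ Flatten) (perms n))

length-perms-suc : ∀ n → length (perms (suc n)) ≡ suc n * length (perms n)
length-perms-suc n = begin
    length (concatMap (extensions n) (perms n))
  ≡⟨ length-concatMap (extensions n) (perms n) ⟩
    sum (map (length ∘ extensions n) (perms n))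
  ≡⟨ sum-map-cong-∈ _ _ (perms n) (λ _ → length-extensions) ⟩
    sum (map (λ _ → suc n) (perms n))
  ≡⟨ sum-map-const (suc n) (perms n) ⟩
    length (perms n) * suc n
  ≡⟨ *-comm (length (perms n)) (suc n) ⟩
    suc n * length (perms n)
  ∎
  where
  open ≡-Reasoning
  length-extensions : ∀ {u} → length (extensions n u) ≡ suc n
  length-extensions {u} = trans (length-++ (map (extendAfter n u) (range n)))
    (trans (cong (_+ 1) (trans (length-map (extendAfter n u) (range n)) (length-range n))) (+-comm n 1))

occ321Total-suc : ∀ n → occ321Total (suc n) + occ321Total n ≡ n * occ321Total n + descentTotal n
occ321Total-suc n = begin
    sum (map (occ321 ∘ Flatten) (concatMap (extensions n) (perms n))) + occ321Total n
  ≡⟨ cong (_+ occ321Total n) (sum-map-concatMap (occ321 ∘ Flatten) (extensions n) (perms n)) ⟩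
    sum (map (λ u → sum (map (occ321 ∘ Flatten) (extensions n u))) (perms n)) + occ321Total n
  ≡⟨ sum-map-+ _ (occ321 ∘ Flatten) (perms n) ⟨
    sum (map (λ u → sum (map (occ321 ∘ Flatten) (extensions n u)) + occ321 (Flatten u)) (perms n))
  ≡⟨ sum-map-cong-∈ _ _ (perms n) (CountExtensions.occ321-extensions ∘ PermInvariant-perms n) ⟩
    sum (map (λ u → n * occ321 (Flatten u) + descents (Flatten u)) (perms n))
  ≡⟨ sum-map-+ _ (descents ∘ Flatten) (perms n) ⟩
    sum (map (λ u → n * occ321 (Flatten u)) (perms n)) + descentTotal n
  ≡⟨ cong (_+ descentTotal n) (sum-map-*ˡ n (occ321 ∘ Flatten) (perms n)) ⟩
    n * occ321Total n + descentTotal n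
  ∎
  where open ≡-Reasoning

descentTotal-suc : ∀ n → 1 ≤ n → descentTotal (suc n) + length (perms n) ≡ n * descentTotal n + n * length (perms n)
descentTotal-suc n 1≤n = begin
    sum (map (descents ∘ Flatten) (concatMap (extensions n) (perms n))) + length (perms n)
  ≡⟨ cong₂ _+_ (sum-map-concatMap (descents ∘ Flatten) (extensions n) (perms n))
               (sym (trans (sum-map-const 1 (perms n)) (*-identityʳ _))) ⟩
    sum (map (λ u → sum (map (descents ∘ Flatten) (extensions n u))) (perms n)) + sum (map (λ _ → 1) (perms n))
  ≡⟨ sum-map-+ _ (λ _ → 1) (perms n) ⟨
    sum (map (λ u → sum (map (descents ∘ Flatten) (extensions n u)) + 1) (perms n))
  ≡⟨ sum-map-cong-∈ _ _ (perms n) (λ u∈ → CountExtensions.descents-extensions (PermInvariant-perms n u∈) 1≤n) ⟩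
    sum (map (λ u → n * descents (Flatten u) + n) (perms n))
  ≡⟨ sum-map-+ _ (λ _ → n) (perms n) ⟩
    sum (map (λ u → n * descents (Flatten u)) (perms n)) + sum (map (λ _ → n) (perms n))
  ≡⟨ cong₂ _+_ (sum-map-*ˡ n (descents ∘ Flatten) (perms n)) (trans (sum-map-const n (perms n)) (*-comm _ n)) ⟩
    n * descentTotal n + n * length (perms n)
  ∎
  where open ≡-Reasoning

descentTotal-closed : ∀ k → 2 * descentTotal (2 + k) ≡ length (perms (1 + k)) * (1 + k) * k
descentTotal-closed zero    = refl
descentTotal-closed (suc k) = +-cancelʳ-≡ (2 * N₂) _ _ (begin
    2 * D₃ + 2 * N₂                                                ≡⟨ *-distribˡ-+ 2 D₃ N₂ ⟨
    2 * (D₃ + N₂)                                                  ≡⟨ cong (2 *_) (descentTotal-suc (2 + k) (s≤s z≤n)) ⟩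
    2 * ((2 + k) * D₂ + (2 + k) * N₂)                              ≡⟨ distribute (2 + k) D₂ N₂ ⟩
    (2 + k) * (2 * D₂) + 2 * ((2 + k) * N₂)                        ≡⟨ cong₂ (λ d m → (2 + k) * d + 2 * ((2 + k) * m))
                                                                              (descentTotal-closed k) (length-perms-suc (1 + k)) ⟩
    (2 + k) * (N₁ * (1 + k) * k) + 2 * ((2 + k) * ((2 + k) * N₁))  ≡⟨ identity k N₁ ⟩
    (2 + k) * N₁ * (2 + k) * (1 + k) + 2 * ((2 + k) * N₁)          ≡⟨ cong (λ m → m * (2 + k) * (1 + k) + 2 * m)
                                                                              (length-perms-suc (1 + k)) ⟨
    N₂ * (2 + k) * (1 + k) + 2 * N₂                                ∎)
  where
  open ≡-Reasoning
  D₂ = descentTotal (2 + k)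
  D₃ = descentTotal (3 + k)
  N₁ = length (perms (1 + k))
  N₂ = length (perms (2 + k))
  distribute : ∀ a d m → 2 * (a * d + a * m) ≡ a * (2 * d) + 2 * (a * m)
  distribute = solve-∀
  identity : ∀ k m → (2 + k) * (m * (1 + k) * k) + 2 * ((2 + k) * ((2 + k) * m))
                   ≡ (2 + k) * m * (2 + k) * (1 + k) + 2 * ((2 + k) * m)
  identity = solve-∀

occ321Total-closed : ∀ k → 6 * occ321Total (3 + k) ≡ length (perms (2 + k)) * (1 + k) * k
occ321Total-closed zero    = refl
occ321Total-closed (suc k) = +-cancelʳ-≡ (6 * O₃) _ _ (begin
    6 * O₄ + 6 * O₃                                         ≡⟨ *-distribˡ-+ 6 O₄ O₃ ⟨
    6 * (O₄ + O₃)                                           ≡⟨ cong (6 *_) (occ321Total-suc (3 + k)) ⟩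
    6 * ((3 + k) * O₃ + D₃)                                 ≡⟨ distribute (3 + k) O₃ D₃ ⟩
    (3 + k) * (6 * O₃) + 3 * (2 * D₃)                       ≡⟨ cong₂ (λ o d → (3 + k) * o + 3 * d)
                                                                       (occ321Total-closed k) (descentTotal-closed (1 + k)) ⟩
    (3 + k) * (N₂ * (1 + k) * k) + 3 * (N₂ * (2 + k) * (1 + k)) ≡⟨ identity k N₂ ⟩
    (3 + k) * N₂ * (2 + k) * (1 + k) + N₂ * (1 + k) * k     ≡⟨ cong₂ (λ m o → m * (2 + k) * (1 + k) + o)
                                                                       (length-perms-suc (2 + k)) (occ321Total-closed k) ⟨
    N₃ * (2 + k) * (1 + k) + 6 * O₃                         ∎)
  where
  open ≡-Reasoning
  O₃ = occ321Total (3 + k)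
  O₄ = occ321Total (4 + k)
  D₃ = descentTotal (3 + k)
  N₂ = length (perms (2 + k))
  N₃ = length (perms (3 + k))
  distribute : ∀ a o d → 6 * (a * o + d) ≡ a * (6 * o) + 3 * (2 * d)
  distribute = solve-∀
  identity : ∀ k m → (3 + k) * (m * (1 + k) * k) + 3 * (m * (2 + k) * (1 + k))
                   ≡ (3 + k) * m * (2 + k) * (1 + k) + m * (1 + k) * k
  identity = solve-∀

occ321Total-perms : ∀ n → 2 ≤ n → 6 * n * occ321Total n ≡ length (perms n) * ((n ∸ 2) * (n ∸ 3))
occ321Total-perms (suc zero)          (s≤s ())
occ321Total-perms (suc (suc zero))    _ = refl
occ321Total-perms (suc (suc (suc k))) _ = begin
  6 * (3 + k) * O₃                 ≡⟨ commute (3 + k) O₃ ⟩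
  (3 + k) * (6 * O₃)               ≡⟨ cong ((3 + k) *_) (occ321Total-closed k) ⟩
  (3 + k) * (N₂ * (1 + k) * k)     ≡⟨ regroup k N₂ ⟩
  (3 + k) * N₂ * ((1 + k) * k)     ≡⟨ cong (_* ((1 + k) * k)) (length-perms-suc (2 + k)) ⟨
  N₃ * ((1 + k) * k)               ∎
  where
  open ≡-Reasoning
  O₃ = occ321Total (3 + k)
  N₂ = length (perms (2 + k))
  N₃ = length (perms (3 + k))
  commute : ∀ a o → 6 * a * o ≡ a * (6 * o)
  commute = solve-∀
  regroup : ∀ k m → (3 + k) * (m * (1 + k) * k) ≡ (3 + k) * m * ((1 + k) * k)
  regroup = solve-∀

corollary3p8 : (n : ℕ) → 2 ≤ n →
    (Sn : List (List ℕ)) → Unique Sn → (∀ w → (w ∈ Sn) ⇔ (w ↭ range n)) →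
    6 * n * sum (map (λ w → occ321 (Flatten w)) Sn)
      ≡ length Sn * ((n ∸ 2) * (n ∸ 3))
corollary3p8 n 2≤n Sn Sn! Sn⇔ = begin
  6 * n * sum (map (occ321 ∘ Flatten) Sn)      ≡⟨ cong (6 * n *_) (sum-↭ (↭-map⁺ (occ321 ∘ Flatten) Sn↭perms)) ⟩
  6 * n * occ321Total n                        ≡⟨ occ321Total-perms n 2≤n ⟩
  length (perms n) * ((n ∸ 2) * (n ∸ 3))       ≡⟨ cong (_* ((n ∸ 2) * (n ∸ 3))) (↭-length Sn↭perms) ⟨
  length Sn * ((n ∸ 2) * (n ∸ 3))              ∎
  where
  open ≡-Reasoning
  Sn↭perms = ↭-perms n Sn! Sn⇔
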